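{- Let $h\ge0$ and $n\ge0$ be integers. The number of plane rooted multi-edge trees with $n$ edges and height $>h$ equals $$\sum_{k\ge0}\biggl(\binom{n-1;1,3,1}{n-(h+1)-(h+2)k}-2\binom{n-1;1,3,1}{n-(h+1)-(h+2)k-2}+\binom{n-1;1,3,1}{n-(h+1)-(h+2)k-4}\biggr),$$ where $\binom{m;1,3,1}{j}=[v^j](1+3v+v^2)^m$ denotes a weighted trinomial coefficient (which is $0$ for $j<0$).
   Context: A plane rooted multi-edge tree is a rooted plane tree in which each non-root vertex is joined to its parent by a positive number of parallel edges; children of a vertex are ordered; its size is its total number of edges; its height is the maximum distance (number of parent-child steps) of a vertex from the root. -}

module Defs where

open import Data.Nat using (ℕ; zero; suc; _+_; _*_; _∸_; _⊔_)
open import Data.Integer as ℤ using (ℤ; +_; -[1+_])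
open import Data.List using (List; []; _∷_)
open import Data.Product using (_×_; _,_)

-- A plane rooted multi-edge tree: the root has an ordered list of children;
-- each child is given as (k , t) meaning the child subtree t is joined to the
-- parent by (suc k) ≥ 1 parallel edges.
data MTree : Set where
  node : List (ℕ × MTree) → MTree

mutual
  size : MTree → ℕ
  size (node cs) = sizeF cs

  sizeF : List (ℕ × MTree) → ℕ
  sizeF [] = 0
  sizeF ((k , t) ∷ cs) = suc k + size t + sizeF cs

mutual
  height : MTree → ℕ
  height (node cs) = heightF cs

  heightF : List (ℕ × MTree) → ℕ
  heightF [] = 0
  heightF ((k , t) ∷ cs) = suc (height t) ⊔ heightF cs

-- Polynomials with ℕ coefficients as coefficient lists (constant term first).
Poly : Set
Poly = List ℕ

_⊕_ : Poly → Poly → Poly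
[] ⊕ q = q
(a ∷ p) ⊕ [] = a ∷ p
(a ∷ p) ⊕ (b ∷ q) = (a + b) ∷ (p ⊕ q)

scale : ℕ → Poly → Poly
scale c [] = []
scale c (a ∷ p) = c * a ∷ scale c p

mulTri : Poly → Poly
mulTri p = p ⊕ ((0 ∷ scale 3 p) ⊕ (0 ∷ 0 ∷ p))

triPow : ℕ → Poly
triPow zero = 1 ∷ []
triPow (suc m) = mulTri (triPow m)

coeff : Poly → ℕ → ℕ
coeff [] j = 0
coeff (a ∷ p) zero = a
coeff (a ∷ p) (suc j) = coeff p j

tri : ℕ → ℤ → ℤ
tri m (+ j) = + coeff (triPow m) j
tri m -[1+ j ] = + 0

sumTo : ℕ → (ℕ → ℤ) → ℤ
sumTo zero f = + 0
sumTo (suc K) f = sumTo K f ℤ.+ f K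

term : ℕ → ℕ → ℕ → ℤ
term n h k =
  tri (n ∸ 1) (e ℤ.- + 0) ℤ.- + 2 ℤ.* tri (n ∸ 1) (e ℤ.- + 2)
    ℤ.+ tri (n ∸ 1) (e ℤ.- + 4)
  where
  e : ℤ
  e = + n ℤ.- + (h + 1) ℤ.- + ((h + 2) * k)

-- The full sum over k ≥ 0; terms with k > n vanish (all indices negative),
-- so summing k = 0 … n is the whole sum.
formula : ℕ → ℕ → ℤ
formula n h = sumTo (suc n) (term n h)

-- Explore a tree of height ≤ h depth first. The states of the traversal are stacks of forests, one
-- per depth d ≤ h, and deleting one edge at a time gives a linear recursion in the size n and the depth
-- d for the number of stacks. With T = 1 + 3X + X² and r = (1 - X²)/(1 - X^(h+2)), the number of stacks
-- of size m + 1 and depth d is [X^(m+1)] (1+X)^(d+1) (1 - X^(h+1-d)) r T^m: the recursion reduces to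
-- T = X + (1+X)², to an identity between power series, and at d = 0 to the palindromy of T^m. Trees of
-- height > h are all trees (of height ≤ n) minus those of height ≤ h; in the difference the common term
-- (1+X)(1 - X²) cancels, leaving [X^n] X^(h+1) (1 - X²)² T^(n-1) / (1 - X^(h+2)), whose expansion is
-- the stated sum.

module Submission where

open import Data.Nat as ℕ using (ℕ; zero; suc; _≤_; _<_; z≤n; s≤s; _⊔_)
import Data.Nat.Properties as ℕₚ
open import Data.Nat.DivMod using (_%_; m<n⇒m%n≡m; [m+n]%n≡m%n)
open import Data.Integer using (ℤ; +_; -[1+_]; _+_; _-_; _*_)
import Data.Integer.Properties as ℤₚ
open import Data.Integer.Tactic.RingSolver using (solve-∀)
open import Data.Fin as Fin using (Fin)
open import Data.Fin.Properties using (+↔⊎)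
open import Data.Fin.Permutation using (↔⇒≡)
open import Data.List using (List; []; _∷_)
open import Data.Vec using (Vec; []; _∷_)
open import Data.Unit using (⊤; tt)
open import Data.Empty using (⊥-elim)
open import Data.Product using (Σ; Σ-syntax; _×_; _,_; proj₁; proj₂; map₂)
open import Data.Product.Function.Dependent.Propositional using (Σ-↔)
open import Data.Sum using (_⊎_; inj₁; inj₂)
open import Data.Sum.Function.Propositional using (_⊎-↔_)
open import Function using (_∘_)
open import Function.Bundles using (_↔_; mk↔ₛ′; Inverse)
open import Function.Properties.Inverse using (↔-trans; ↔-sym)
open import Relation.Nullary using (Dec; yes; no; ¬_; Irrelevant)
open import Relation.Binary.PropositionalEquality hiding ([_])
open ≡-Reasoning

open import Defs

[_≤_] : ℕ → ℕ → ℕ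
[ zero  ≤ k     ] = 1
[ suc d ≤ zero  ] = 0
[ suc d ≤ suc k ] = [ d ≤ k ]

[≤]-true : ∀ {d k} → d ≤ k → [ d ≤ k ] ≡ 1
[≤]-true z≤n       = refl
[≤]-true (s≤s d≤k) = [≤]-true d≤k

[≤]-false : ∀ {d k} → k < d → [ d ≤ k ] ≡ 0
[≤]-false {suc d} {zero}  _         = refl
[≤]-false {suc d} {suc k} (s≤s k<d) = [≤]-false k<d

suc-∸ : ∀ {m n} → n ≤ m → suc m ℕ.∸ n ≡ suc (m ℕ.∸ n)
suc-∸ z≤n       = refl
suc-∸ (s≤s n≤m) = suc-∸ n≤m

-- Power series over ℤ in one variable X

Seq : Set
Seq = ℕ → ℤ

infixl 6 _⊞_ _⊟_
infixr 8 X·_ X^_·_ [1+X]·_ [1+X]^_·_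

_⊞_ _⊟_ : Seq → Seq → Seq
(f ⊞ g) a = f a + g a
(f ⊟ g) a = f a - g a

X·_ : Seq → Seq
(X· f) zero    = + 0
(X· f) (suc a) = f a

X^_·_ : ℕ → Seq → Seq
X^ zero  · f = f
X^ suc k · f = X· X^ k · f

[1+X]·_ : Seq → Seq
[1+X]· f = f ⊞ X· f

[1+X]^_·_ : ℕ → Seq → Seq
[1+X]^ zero  · f = f
[1+X]^ suc k · f = [1+X]· [1+X]^ k · f

δ : Seq
δ zero    = + 1
δ (suc _) = + 0

⊟-cong : ∀ {f f′ g g′} → f ≗ f′ → g ≗ g′ → f ⊟ g ≗ f′ ⊟ g′
⊟-cong f≗f′ g≗g′ a = cong₂ _-_ (f≗f′ a) (g≗g′ a)

X·-cong : ∀ {f g} → f ≗ g → X· f ≗ X· g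
X·-cong f≗g zero    = refl
X·-cong f≗g (suc a) = f≗g a

X·-⊟ : ∀ f g → X· (f ⊟ g) ≗ X· f ⊟ X· g
X·-⊟ f g zero    = refl
X·-⊟ f g (suc a) = refl

X·-⊞ : ∀ f g → X· (f ⊞ g) ≗ X· f ⊞ X· g
X·-⊞ f g zero    = refl
X·-⊞ f g (suc a) = refl

X^-cong : ∀ k {f g} → f ≗ g → X^ k · f ≗ X^ k · g
X^-cong zero    f≗g = f≗g
X^-cong (suc k) f≗g = X·-cong (X^-cong k f≗g)

X^-⊟ : ∀ k f g → X^ k · (f ⊟ g) ≗ X^ k · f ⊟ X^ k · g
X^-⊟ zero    f g a = refl
X^-⊟ (suc k) f g a = trans (X·-cong (X^-⊟ k f g) a) (X·-⊟ (X^ k · f) (X^ k · g) a)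

X^-X· : ∀ k f → X^ k · X· f ≗ X· X^ k · f
X^-X· zero    f a = refl
X^-X· (suc k) f   = X·-cong (X^-X· k f)

X^-below : ∀ k f {a} → a < k → (X^ k · f) a ≡ + 0
X^-below (suc k) f {zero}  _         = refl
X^-below (suc k) f {suc a} (s≤s a<k) = X^-below k f a<k

X^-shift : ∀ k f a → (X^ k · f) (k ℕ.+ a) ≡ f a
X^-shift zero    f a = refl
X^-shift (suc k) f a = X^-shift k f a

[1+X]-cong : ∀ {f g} → f ≗ g → [1+X]· f ≗ [1+X]· g
[1+X]-cong f≗g a = cong₂ _+_ (f≗g a) (X·-cong f≗g a)

[1+X]^-cong : ∀ k {f g} → f ≗ g → [1+X]^ k · f ≗ [1+X]^ k · g
[1+X]^-cong zero    f≗g = f≗g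
[1+X]^-cong (suc k) f≗g = [1+X]-cong ([1+X]^-cong k f≗g)

[1+X]-⊟ : ∀ f g → [1+X]· (f ⊟ g) ≗ [1+X]· f ⊟ [1+X]· g
[1+X]-⊟ f g a = begin
  (f a - g a) + (X· (f ⊟ g)) a      ≡⟨ cong (λ x → (f a - g a) + x) (X·-⊟ f g a) ⟩
  (f a - g a) + ((X· f) a - (X· g) a) ≡⟨ interchange (f a) (g a) ((X· f) a) ((X· g) a) ⟩
  (f a + (X· f) a) - (g a + (X· g) a) ∎
  where
  interchange : ∀ p q r s → (p - q) + (r - s) ≡ (p + r) - (q + s)
  interchange = solve-∀

[1+X]^-⊟ : ∀ k f g → [1+X]^ k · (f ⊟ g) ≗ [1+X]^ k · f ⊟ [1+X]^ k · g
[1+X]^-⊟ zero    f g a = refl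
[1+X]^-⊟ (suc k) f g a =
  trans ([1+X]-cong ([1+X]^-⊟ k f g) a) ([1+X]-⊟ ([1+X]^ k · f) ([1+X]^ k · g) a)

X·-[1+X] : ∀ f → X· [1+X]· f ≗ [1+X]· X· f
X·-[1+X] f = X·-⊞ f (X· f)

X^-[1+X] : ∀ k f → X^ k · [1+X]· f ≗ [1+X]· X^ k · f
X^-[1+X] zero    f a = refl
X^-[1+X] (suc k) f a = trans (X·-cong (X^-[1+X] k f) a) (X·-[1+X] (X^ k · f) a)

-- (1+X)(1 - X^(b+1)) - (1 - X^(b+2)) = X - X^(b+1) = X (1 - X^b).
[1+X]²-difference : ∀ V b →
  [1+X]^ 2 · (([1+X]· V ⊟ X^ suc b · [1+X]· V) ⊟ (V ⊟ X^ suc (suc b) · V))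
  ≗ X· ([1+X]^ 2 · V ⊟ X^ b · [1+X]^ 2 · V)
[1+X]²-difference V b a = begin
  ([1+X]^ 2 · Δ) a                                ≡⟨ [1+X]^-cong 2 Δ≗XV-Y a ⟩
  ([1+X]^ 2 · (X· V ⊟ Y)) a                        ≡⟨ [1+X]^-⊟ 2 (X· V) Y a ⟩
  ([1+X]^ 2 · X· V) a - ([1+X]^ 2 · Y) a
    ≡⟨ cong₂ _-_ (trans ([1+X]-cong (λ c → sym (X·-[1+X] V c)) a) (sym (X·-[1+X] ([1+X]· V) a)))
                 (trans ([1+X]-cong (λ c → sym (X^-[1+X] (suc b) V c)) a) (sym (X^-[1+X] (suc b) ([1+X]· V) a))) ⟩
  (X· [1+X]^ 2 · V) a - (X^ suc b · [1+X]^ 2 · V) a ≡⟨ X·-⊟ ([1+X]^ 2 · V) (X^ b · [1+X]^ 2 · V) a ⟨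
  (X· ([1+X]^ 2 · V ⊟ X^ b · [1+X]^ 2 · V)) a       ∎
  where
  Y  = X^ suc b · V
  Δ  = ([1+X]· V ⊟ X^ suc b · [1+X]· V) ⊟ (V ⊟ X· Y)
  cancel : ∀ v xv y xy → (v + xv - (y + xy)) - (v - xy) ≡ xv - y
  cancel = solve-∀
  Δ≗XV-Y : Δ ≗ X· V ⊟ Y
  Δ≗XV-Y c = trans (cong (λ z → ([1+X]· V) c - z - (V c - (X· Y) c)) (X^-[1+X] (suc b) V c))
                   (cancel (V c) ((X· V) c) (Y c) ((X· Y) c))

sumTo-cong : ∀ K {f g : ℕ → ℤ} → (∀ a → a < K → f a ≡ g a) → sumTo K f ≡ sumTo K g
sumTo-cong zero    f≡g = refl
sumTo-cong (suc K) f≡g =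
  cong₂ _+_ (sumTo-cong K (λ a a<K → f≡g a (ℕₚ.m≤n⇒m≤1+n a<K))) (f≡g K ℕₚ.≤-refl)

sumTo-zero : ∀ K (f : ℕ → ℤ) → (∀ a → f a ≡ + 0) → sumTo K f ≡ + 0
sumTo-zero zero    f f≡0 = refl
sumTo-zero (suc K) f f≡0 = cong₂ _+_ (sumTo-zero K f f≡0) (f≡0 K)

sumTo-+ : ∀ K (f g : ℕ → ℤ) → sumTo K (λ a → f a + g a) ≡ sumTo K f + sumTo K g
sumTo-+ zero    f g = refl
sumTo-+ (suc K) f g = begin
  sumTo K (λ a → f a + g a) + (f K + g K) ≡⟨ cong (_+ (f K + g K)) (sumTo-+ K f g) ⟩
  (sumTo K f + sumTo K g) + (f K + g K)   ≡⟨ interchange (sumTo K f) (sumTo K g) (f K) (g K) ⟩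
  (sumTo K f + f K) + (sumTo K g + g K)   ∎
  where
  interchange : ∀ p q r s → (p + q) + (r + s) ≡ (p + r) + (q + s)
  interchange = solve-∀

sumTo-minus : ∀ K (f g : ℕ → ℤ) → sumTo K (λ a → f a - g a) ≡ sumTo K f - sumTo K g
sumTo-minus zero    f g = refl
sumTo-minus (suc K) f g = begin
  sumTo K (λ a → f a - g a) + (f K - g K) ≡⟨ cong (_+ (f K - g K)) (sumTo-minus K f g) ⟩
  (sumTo K f - sumTo K g) + (f K - g K)   ≡⟨ interchange (sumTo K f) (sumTo K g) (f K) (g K) ⟩
  (sumTo K f + f K) - (sumTo K g + g K)   ∎
  where
  interchange : ∀ p q r s → (p - q) + (r - s) ≡ (p + r) - (q + s)
  interchange = solve-∀

sumTo-*ˡ : ∀ K c (f : ℕ → ℤ) → sumTo K (λ a → c * f a) ≡ c * sumTo K f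
sumTo-*ˡ zero    c f = sym (ℤₚ.*-zeroʳ c)
sumTo-*ˡ (suc K) c f = begin
  sumTo K (λ a → c * f a) + c * f K ≡⟨ cong (_+ c * f K) (sumTo-*ˡ K c f) ⟩
  c * sumTo K f + c * f K           ≡⟨ ℤₚ.*-distribˡ-+ c (sumTo K f) (f K) ⟨
  c * (sumTo K f + f K)             ∎

sumTo-sucˡ : ∀ K (f : ℕ → ℤ) → sumTo (suc K) f ≡ f 0 + sumTo K (λ a → f (suc a))
sumTo-sucˡ zero    f = ℤₚ.+-comm (+ 0) (f 0)
sumTo-sucˡ (suc K) f = begin
  sumTo (suc K) f + f (suc K)                   ≡⟨ cong (_+ f (suc K)) (sumTo-sucˡ K f) ⟩
  (f 0 + sumTo K (λ a → f (suc a))) + f (suc K) ≡⟨ ℤₚ.+-assoc (f 0) _ _ ⟩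
  f 0 + (sumTo K (λ a → f (suc a)) + f (suc K)) ∎

-- Weighted trinomial coefficients

coeffℤ : Poly → ℤ → ℤ
coeffℤ p (+ j)    = + coeff p j
coeffℤ p -[1+ j ] = + 0

tri≡coeffℤ : ∀ m z → tri m z ≡ coeffℤ (triPow m) z
tri≡coeffℤ m (+ j)    = refl
tri≡coeffℤ m -[1+ j ] = refl

coeff-⊕ : ∀ p q j → coeff (p ⊕ q) j ≡ coeff p j ℕ.+ coeff q j
coeff-⊕ []      q       j       = refl
coeff-⊕ (a ∷ p) []      j       = sym (ℕₚ.+-identityʳ _)
coeff-⊕ (a ∷ p) (b ∷ q) zero    = refl
coeff-⊕ (a ∷ p) (b ∷ q) (suc j) = coeff-⊕ p q j

coeff-scale : ∀ c p j → coeff (scale c p) j ≡ c ℕ.* coeff p j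
coeff-scale c []      j       = sym (ℕₚ.*-zeroʳ c)
coeff-scale c (a ∷ p) zero    = refl
coeff-scale c (a ∷ p) (suc j) = coeff-scale c p j

coeffℤ-⊕ : ∀ p q z → coeffℤ (p ⊕ q) z ≡ coeffℤ p z + coeffℤ q z
coeffℤ-⊕ p q (+ j)    = cong +_ (coeff-⊕ p q j)
coeffℤ-⊕ p q -[1+ j ] = refl

coeffℤ-scale : ∀ c p z → coeffℤ (scale c p) z ≡ + c * coeffℤ p z
coeffℤ-scale c p (+ j)    = trans (cong +_ (coeff-scale c p j)) (ℤₚ.pos-* c (coeff p j))
coeffℤ-scale c p -[1+ j ] = sym (ℤₚ.*-zeroʳ (+ c))

coeffℤ-X : ∀ p z → coeffℤ (0 ∷ p) z ≡ coeffℤ p (z - + 1)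
coeffℤ-X p (+ zero)    = refl
coeffℤ-X p (+ suc j)   =
  cong (coeffℤ p) (sym (trans (ℤₚ.[+m]-[+n]≡m⊖n (suc j) 1) (ℤₚ.⊖-≥ (s≤s z≤n))))
coeffℤ-X p -[1+ j ]    = refl

coeffℤ-mulTri : ∀ p z → coeffℤ (mulTri p) z ≡ coeffℤ p z + + 3 * coeffℤ p (z - + 1) + coeffℤ p (z - + 2)
coeffℤ-mulTri p z = begin
  coeffℤ (p ⊕ ((0 ∷ scale 3 p) ⊕ (0 ∷ 0 ∷ p))) z        ≡⟨ coeffℤ-⊕ p _ z ⟩
  coeffℤ p z + coeffℤ ((0 ∷ scale 3 p) ⊕ (0 ∷ 0 ∷ p)) z ≡⟨ cong (λ x → coeffℤ p z + x) (coeffℤ-⊕ (0 ∷ scale 3 p) (0 ∷ 0 ∷ p) z) ⟩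
  coeffℤ p z + (coeffℤ (0 ∷ scale 3 p) z + coeffℤ (0 ∷ 0 ∷ p) z)
    ≡⟨ cong₂ (λ x y → coeffℤ p z + (x + y))
             (trans (coeffℤ-X (scale 3 p) z) (coeffℤ-scale 3 p (z - + 1)))
             (trans (coeffℤ-X (0 ∷ p) z) (coeffℤ-X p (z - + 1))) ⟩
  coeffℤ p z + (+ 3 * coeffℤ p (z - + 1) + coeffℤ p (z - + 1 - + 1))
    ≡⟨ cong (λ i → coeffℤ p z + (+ 3 * coeffℤ p (z - + 1) + coeffℤ p i)) (twice z) ⟩
  coeffℤ p z + (+ 3 * coeffℤ p (z - + 1) + coeffℤ p (z - + 2))
    ≡⟨ ℤₚ.+-assoc (coeffℤ p z) _ _ ⟨
  coeffℤ p z + + 3 * coeffℤ p (z - + 1) + coeffℤ p (z - + 2) ∎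
  where
  twice : ∀ z → z - + 1 - + 1 ≡ z - + 2
  twice = solve-∀

tri-suc : ∀ m z → tri (suc m) z ≡ tri m z + + 3 * tri m (z - + 1) + tri m (z - + 2)
tri-suc m z
  rewrite tri≡coeffℤ (suc m) z | tri≡coeffℤ m z | tri≡coeffℤ m (z - + 1) | tri≡coeffℤ m (z - + 2)
  = coeffℤ-mulTri (triPow m) z

tri-negative : ∀ m {n k} → n < k → tri m (+ n - + k) ≡ + 0
tri-negative m {zero}  {suc k} _         = refl
tri-negative m {suc n} {suc k} (s≤s n<k) = trans (cong (tri m) (cancel (+ n) (+ k))) (tri-negative m n<k)
  where
  cancel : ∀ a b → (+ 1 + a) - (+ 1 + b) ≡ a - b
  cancel = solve-∀

tri-palindromic : ∀ m z → tri m (+ m + z) ≡ tri m (+ m - z)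
tri-palindromic zero    (+ zero)  = refl
tri-palindromic zero    (+ suc k) = refl
tri-palindromic zero    -[1+ k ]  = refl
tri-palindromic (suc m) z = begin
  tri (suc m) (M′ + z)                                        ≡⟨ tri-suc m _ ⟩
  tri m (M′ + z) + + 3 * tri m (M′ + z - + 1) + tri m (M′ + z - + 2)
    ≡⟨ tri₃-cong (up₁ M z) (up₀ M z) (up₋₁ M z) ⟩
  tri m (M + (z + + 1)) + + 3 * tri m (M + z) + tri m (M + (z - + 1))
    ≡⟨ cong₂ _+_ (cong₂ (λ x y → x + + 3 * y) (tri-palindromic m (z + + 1)) (tri-palindromic m z))
                 (tri-palindromic m (z - + 1)) ⟩
  tri m (M - (z + + 1)) + + 3 * tri m (M - z) + tri m (M - (z - + 1))
    ≡⟨ swap (tri m (M - (z + + 1))) (tri m (M - z)) (tri m (M - (z - + 1))) ⟩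
  tri m (M - (z - + 1)) + + 3 * tri m (M - z) + tri m (M - (z + + 1))
    ≡⟨ tri₃-cong (down₁ M z) (down₀ M z) (down₋₁ M z) ⟩
  tri m (M′ - z) + + 3 * tri m (M′ - z - + 1) + tri m (M′ - z - + 2) ≡⟨ tri-suc m _ ⟨
  tri (suc m) (M′ - z)                                        ∎
  where
  M M′ : ℤ
  M  = + m
  M′ = + suc m
  tri₃-cong : ∀ {a a′ b b′ c c′} → a ≡ a′ → b ≡ b′ → c ≡ c′ →
              tri m a + + 3 * tri m b + tri m c ≡ tri m a′ + + 3 * tri m b′ + tri m c′
  tri₃-cong refl refl refl = refl
  up₁ : ∀ M z → (+ 1 + M) + z ≡ M + (z + + 1)
  up₁ = solve-∀
  up₀ : ∀ M z → (+ 1 + M) + z - + 1 ≡ M + z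
  up₀ = solve-∀
  up₋₁ : ∀ M z → (+ 1 + M) + z - + 2 ≡ M + (z - + 1)
  up₋₁ = solve-∀
  down₁ : ∀ M z → M - (z - + 1) ≡ (+ 1 + M) - z
  down₁ = solve-∀
  down₀ : ∀ M z → M - z ≡ (+ 1 + M) - z - + 1
  down₀ = solve-∀
  down₋₁ : ∀ M z → M - (z + + 1) ≡ (+ 1 + M) - z - + 2
  down₋₁ = solve-∀
  swap : ∀ a b c → a + + 3 * b + c ≡ c + + 3 * b + a
  swap = solve-∀

-- Coefficient extraction against powers of T = 1 + 3X + X²

-- The coefficient of X^(n - j) in f · T^m: summing over a ≤ n suffices because tri vanishes at
-- negative exponents, and the result is 0 when n < j.
coeffT : ℕ → ℕ → ℕ → Seq → ℤ
coeffT m n j f = sumTo (suc n) (λ a → f a * tri m (+ n - + (a ℕ.+ j)))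

coeffT-cong : ∀ m n j {f g} → f ≗ g → coeffT m n j f ≡ coeffT m n j g
coeffT-cong m n j f≗g = sumTo-cong (suc n) (λ a _ → cong (_* tri m (+ n - + (a ℕ.+ j))) (f≗g a))

coeffT-zero : ∀ m n j f → (∀ a → f a ≡ + 0) → coeffT m n j f ≡ + 0
coeffT-zero m n j f f≡0 =
  sumTo-zero (suc n) _ (λ a → cong (_* tri m (+ n - + (a ℕ.+ j))) (f≡0 a))

coeffT-vanish : ∀ m {n j} f → n < j → coeffT m n j f ≡ + 0
coeffT-vanish m {n} {j} f n<j = sumTo-zero (suc n) _ λ a →
  trans (cong (f a *_) (tri-negative m (ℕₚ.<-≤-trans n<j (ℕₚ.m≤n+m j a)))) (ℤₚ.*-zeroʳ (f a))

coeffT-⊞ : ∀ m n j f g → coeffT m n j (f ⊞ g) ≡ coeffT m n j f + coeffT m n j g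
coeffT-⊞ m n j f g = trans
  (sumTo-cong (suc n) (λ a _ → ℤₚ.*-distribʳ-+ (tri m (+ n - + (a ℕ.+ j))) (f a) (g a)))
  (sumTo-+ (suc n) _ _)

coeffT-⊟ : ∀ m n j f g → coeffT m n j (f ⊟ g) ≡ coeffT m n j f - coeffT m n j g
coeffT-⊟ m n j f g = trans
  (sumTo-cong (suc n) (λ a _ → distrib (f a) (g a) (tri m (+ n - + (a ℕ.+ j)))))
  (sumTo-minus (suc n) _ _)
  where
  distrib : ∀ x y t → (x - y) * t ≡ x * t - y * t
  distrib = solve-∀

coeffT-δ : ∀ m n j → coeffT m n j δ ≡ tri m (+ n - + j)
coeffT-δ m n j = begin
  coeffT m n j δ ≡⟨ sumTo-sucˡ n _ ⟩
  + 1 * tri m (+ n - + j) + sumTo n (λ a → + 0 * tri m (+ n - + (suc a ℕ.+ j)))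
    ≡⟨ cong₂ _+_ (ℤₚ.*-identityˡ (tri m (+ n - + j))) (sumTo-zero n _ (λ a → ℤₚ.*-zeroˡ (tri m (+ n - + (suc a ℕ.+ j))))) ⟩
  tri m (+ n - + j) + + 0 ≡⟨ ℤₚ.+-identityʳ (tri m (+ n - + j)) ⟩
  tri m (+ n - + j) ∎

coeffT-X· : ∀ m n j f → coeffT m n j (X· f) ≡ coeffT m n (suc j) f
coeffT-X· m n j f = begin
  coeffT m n j (X· f) ≡⟨ sumTo-sucˡ n _ ⟩
  + 0 * tri m (+ n - + j) + sumTo n (λ a → f a * tri m (+ n - + (suc a ℕ.+ j)))
    ≡⟨ cong₂ _+_ (ℤₚ.*-zeroˡ (tri m (+ n - + j))) (sumTo-cong n (λ a _ → cong (λ i → f a * tri m (+ n - + i)) (sym (ℕₚ.+-suc a j)))) ⟩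
  + 0 + S ≡⟨ ℤₚ.+-comm (+ 0) S ⟩
  S + + 0 ≡⟨ cong (λ x → S + x) last-vanishes ⟨
  coeffT m n (suc j) f ∎
  where
  S = sumTo n (λ a → f a * tri m (+ n - + (a ℕ.+ suc j)))
  last-vanishes : f n * tri m (+ n - + (n ℕ.+ suc j)) ≡ + 0
  last-vanishes = trans (cong (f n *_) (tri-negative m (ℕₚ.m<m+n n (s≤s z≤n)))) (ℤₚ.*-zeroʳ (f n))

coeffT-X^ : ∀ m n k j f → coeffT m n j (X^ k · f) ≡ coeffT m n (k ℕ.+ j) f
coeffT-X^ m n zero    j f = refl
coeffT-X^ m n (suc k) j f = begin
  coeffT m n j (X· X^ k · f)       ≡⟨ coeffT-X· m n j (X^ k · f) ⟩
  coeffT m n (suc j) (X^ k · f)    ≡⟨ coeffT-X^ m n k (suc j) f ⟩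
  coeffT m n (k ℕ.+ suc j) f       ≡⟨ cong (λ i → coeffT m n i f) (ℕₚ.+-suc k j) ⟩
  coeffT m n (suc k ℕ.+ j) f       ∎

coeffT-[1+X] : ∀ m n j f → coeffT m n j ([1+X]· f) ≡ coeffT m n j f + coeffT m n (suc j) f
coeffT-[1+X] m n j f = trans (coeffT-⊞ m n j f (X· f)) (cong (λ x → coeffT m n j f + x) (coeffT-X· m n j f))

coeffT-suc-suc : ∀ m n j f → coeffT m (suc n) (suc j) f ≡ coeffT m n j f
coeffT-suc-suc m n j f = begin
  sumTo (suc n) (λ a → f a * tri m (+ suc n - + (a ℕ.+ suc j))) + f (suc n) * tri m (+ suc n - + (suc n ℕ.+ suc j))
    ≡⟨ cong₂ _+_ (sumTo-cong (suc n) (λ a _ → cong (λ i → f a * tri m i) (shift-index a))) last-vanishes ⟩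
  coeffT m n j f + + 0 ≡⟨ ℤₚ.+-identityʳ _ ⟩
  coeffT m n j f       ∎
  where
  cancel : ∀ N A → (+ 1 + N) - (+ 1 + A) ≡ N - A
  cancel = solve-∀
  shift-index : ∀ a → + suc n - + (a ℕ.+ suc j) ≡ + n - + (a ℕ.+ j)
  shift-index a = trans (cong (λ i → + suc n - + i) (ℕₚ.+-suc a j)) (cancel (+ n) (+ (a ℕ.+ j)))
  last-vanishes : f (suc n) * tri m (+ suc n - + (suc n ℕ.+ suc j)) ≡ + 0
  last-vanishes =
    trans (cong (f (suc n) *_) (tri-negative m (ℕₚ.m<m+n (suc n) (s≤s z≤n)))) (ℤₚ.*-zeroʳ (f (suc n)))

coeffT-suc : ∀ m n j f →
  coeffT (suc m) n j f ≡ coeffT m n j f + + 3 * coeffT m n (suc j) f + coeffT m n (2 ℕ.+ j) f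
coeffT-suc m n j f = begin
  coeffT (suc m) n j f
    ≡⟨ sumTo-cong (suc n) (λ a _ → termwise a) ⟩
  sumTo (suc n) (λ a → (f a * tri m (I 0 a) + + 3 * (f a * tri m (I 1 a))) + f a * tri m (I 2 a))
    ≡⟨ sumTo-+ (suc n) _ _ ⟩
  sumTo (suc n) (λ a → f a * tri m (I 0 a) + + 3 * (f a * tri m (I 1 a))) + coeffT m n (2 ℕ.+ j) f
    ≡⟨ cong (_+ coeffT m n (2 ℕ.+ j) f)
            (trans (sumTo-+ (suc n) _ _) (cong (λ x → coeffT m n j f + x) (sumTo-*ˡ (suc n) (+ 3) _))) ⟩
  coeffT m n j f + + 3 * coeffT m n (suc j) f + coeffT m n (2 ℕ.+ j) f ∎
  where
  I : ℕ → ℕ → ℤ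
  I k a = + n - + (a ℕ.+ (k ℕ.+ j))
  shift : ∀ k a → + n - + (a ℕ.+ j) - + k ≡ I k a
  shift k a = trans (regroup (+ n) (+ a) (+ j) (+ k)) (cong (λ i → + n - + i) (sym (swap-last a k j)))
    where
    regroup : ∀ N A J K → N - (A + J) - K ≡ N - (A + J + K)
    regroup = solve-∀
    swap-last : ∀ a k j → a ℕ.+ (k ℕ.+ j) ≡ a ℕ.+ j ℕ.+ k
    swap-last a k j = trans (cong (a ℕ.+_) (ℕₚ.+-comm k j)) (sym (ℕₚ.+-assoc a j k))
  distrib : ∀ x p q r → x * (p + + 3 * q + r) ≡ (x * p + + 3 * (x * q)) + x * r
  distrib = solve-∀
  termwise : ∀ a → f a * tri (suc m) (I 0 a) ≡ (f a * tri m (I 0 a) + + 3 * (f a * tri m (I 1 a))) + f a * tri m (I 2 a)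
  termwise a = begin
    f a * tri (suc m) (I 0 a) ≡⟨ cong (f a *_) (tri-suc m _) ⟩
    f a * (tri m (I 0 a) + + 3 * tri m (I 0 a - + 1) + tri m (I 0 a - + 2))
      ≡⟨ cong₂ (λ x y → f a * (tri m (I 0 a) + + 3 * tri m x + tri m y)) (shift 1 a) (shift 2 a) ⟩
    f a * (tri m (I 0 a) + + 3 * tri m (I 1 a) + tri m (I 2 a)) ≡⟨ distrib (f a) _ _ _ ⟩
    (f a * tri m (I 0 a) + + 3 * (f a * tri m (I 1 a))) + f a * tri m (I 2 a) ∎

-- T = X + (1 + X)²
coeffT-suc-[1+X]² : ∀ m n j f → coeffT (suc m) n j f ≡ coeffT m n (suc j) f + coeffT m n j ([1+X]^ 2 · f)
coeffT-suc-[1+X]² m n j f = begin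
  coeffT (suc m) n j f ≡⟨ coeffT-suc m n j f ⟩
  c₀ + + 3 * c₁ + c₂   ≡⟨ regroup c₀ c₁ c₂ ⟩
  c₁ + ((c₀ + c₁) + (c₁ + c₂))
    ≡⟨ cong (λ x → c₁ + x) (sym (trans (coeffT-[1+X] m n j ([1+X]· f))
                                        (cong₂ _+_ (coeffT-[1+X] m n j f) (coeffT-[1+X] m n (suc j) f)))) ⟩
  c₁ + coeffT m n j ([1+X]^ 2 · f) ∎
  where
  c₀ = coeffT m n j f
  c₁ = coeffT m n (suc j) f
  c₂ = coeffT m n (2 ℕ.+ j) f
  regroup : ∀ a b c → a + + 3 * b + c ≡ b + ((a + b) + (b + c))
  regroup = solve-∀

coeffT-at-0-1 : ∀ f → coeffT 0 1 0 f ≡ f 1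
coeffT-at-0-1 f = simplify (f 0) (f 1)
  where
  simplify : ∀ x y → (+ 0 + x * + 0) + y * + 1 ≡ y
  simplify = solve-∀

⊎-↔-Fin : ∀ {A B : Set} {a b} → A ↔ Fin a → B ↔ Fin b → (A ⊎ B) ↔ Fin (a ℕ.+ b)
⊎-↔-Fin A↔a B↔b = ↔-trans (A↔a ⊎-↔ B↔b) (↔-sym +↔⊎)

¬↔Fin0 : ∀ {A : Set} → ¬ A → A ↔ Fin 0
¬↔Fin0 ¬a = mk↔ₛ′ (λ a → ⊥-elim (¬a a)) (λ ()) (λ ()) (λ a → ⊥-elim (¬a a))

≡0↔Fin : ∀ n → (n ≡ 0) ↔ Fin [ n ≤ 0 ]
≡0↔Fin zero    = mk↔ₛ′ (λ _ → Fin.zero) (λ _ → refl) (λ { Fin.zero → refl ; (Fin.suc ()) }) (λ _ → ℕₚ.≡-irrelevant _ _)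
≡0↔Fin (suc n) = ¬↔Fin0 (λ ())

irrelevant-↔ : ∀ {A B : Set} → Irrelevant A → Irrelevant B → (A → B) → (B → A) → A ↔ B
irrelevant-↔ irrA irrB f g = mk↔ₛ′ f g (λ _ → irrB _ _) (λ _ → irrA _ _)

inhabited-irrelevant↔Fin1 : ∀ {A : Set} → A → Irrelevant A → A ↔ Fin 1
inhabited-irrelevant↔Fin1 a irr =
  mk↔ₛ′ (λ _ → Fin.zero) (λ _ → a) (λ { Fin.zero → refl ; (Fin.suc ()) }) (irr a)

Σ-Fin-suc : ∀ {a} (P : Fin (suc a) → Set) → Σ (Fin (suc a)) P ↔ (P Fin.zero ⊎ Σ (Fin a) (P ∘ Fin.suc))
Σ-Fin-suc P = mk↔ₛ′ to from (λ { (inj₁ _) → refl ; (inj₂ _) → refl }) (λ { (Fin.zero , _) → refl ; (Fin.suc _ , _) → refl })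
  where
  to : Σ (Fin _) P → P Fin.zero ⊎ Σ (Fin _) (P ∘ Fin.suc)
  to (Fin.zero  , p) = inj₁ p
  to (Fin.suc i , p) = inj₂ (i , p)
  from : P Fin.zero ⊎ Σ (Fin _) (P ∘ Fin.suc) → Σ (Fin _) P
  from (inj₁ p)       = Fin.zero , p
  from (inj₂ (i , p)) = Fin.suc i , p

Fin-subset : ∀ a (P : Fin a → Set) → (∀ i → Dec (P i)) → (∀ i → Irrelevant (P i)) →
             Σ[ p ∈ ℕ ] (Σ (Fin a) P ↔ Fin p)
Fin-subset zero    P P? irr = 0 , ¬↔Fin0 (λ { (() , _) })
Fin-subset (suc a) P P? irr with Fin-subset a (P ∘ Fin.suc) (P? ∘ Fin.suc) (irr ∘ Fin.suc) | P? Fin.zero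
... | p , rest | yes p₀ = suc p , ↔-trans (Σ-Fin-suc P) (⊎-↔-Fin (inhabited-irrelevant↔Fin1 p₀ (irr Fin.zero)) rest)
... | p , rest | no ¬p₀ = p     , ↔-trans (Σ-Fin-suc P) (⊎-↔-Fin (¬↔Fin0 ¬p₀) rest)

finite-subset : ∀ {A : Set} {a} → A ↔ Fin a → (P : A → Set) → (∀ x → Dec (P x)) → (∀ x → Irrelevant (P x)) →
                Σ[ p ∈ ℕ ] (Σ A P ↔ Fin p)
finite-subset {a = a} A↔a P P? irr =
  map₂ (↔-trans (Σ-↔ A↔a transport)) (Fin-subset a (P ∘ from) (P? ∘ from) (irr ∘ from))
  where
  open Inverse A↔a using (to; from; strictlyInverseʳ)
  transport : ∀ {x} → P x ↔ P (from (to x))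
  transport {x} = irrelevant-↔ (irr x) (irr _) (subst P (sym (strictlyInverseʳ x))) (subst P (strictlyInverseʳ x))

Forest : Set
Forest = List (ℕ × MTree)

module Traversal (h : ℕ) where

  -- The stack g_(d-1) ∷ … ∷ g_0 holds the forests still to be visited at depths d-1, …, 0 in a
  -- depth-first traversal; the height bound h of the whole tree becomes height g_i ≤ h - i.
  Fits : ∀ d → Vec Forest d → Set
  Fits zero    []       = ⊤
  Fits (suc d) (g ∷ gs) = d ℕ.+ heightF g ≤ h × Fits d gs

  Fits-irrelevant : ∀ d gs → Irrelevant (Fits d gs)
  Fits-irrelevant zero    []       tt       tt         = refl
  Fits-irrelevant (suc d) (g ∷ gs) (p , q)  (p′ , q′)  = cong₂ _,_ (ℕₚ.≤-irrelevant p p′) (Fits-irrelevant d gs q q′)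

  totalSize : ∀ {d} → Vec Forest d → ℕ
  totalSize []       = 0
  totalSize (g ∷ gs) = sizeF g ℕ.+ totalSize gs

  Stack : ℕ → ℕ → Set
  Stack n d = Σ[ gs ∈ Vec Forest (suc d) ] (totalSize gs ≡ n × Fits (suc d) gs)

  -- Stacks whose top forest is nonempty, given by its first child (k , t), the rest c and the lower forests.
  Stack⁺ : ℕ → ℕ → Set
  Stack⁺ n d = Σ[ k ∈ ℕ ] Σ[ t ∈ MTree ] Σ[ c ∈ Forest ] Σ[ gs ∈ Vec Forest d ]
    (totalSize (((k , t) ∷ c) ∷ gs) ≡ n × Fits (suc d) (((k , t) ∷ c) ∷ gs))

  Stack-≡ : ∀ {n d} gs {e e′ v v′} → _≡_ {A = Stack n d} (gs , e , v) (gs , e′ , v′)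
  Stack-≡ {d = d} gs = cong₂ (λ x y → gs , x , y) (ℕₚ.≡-irrelevant _ _) (Fits-irrelevant (suc d) gs _ _)

  Stack⁺-≡ : ∀ {n d} k t c gs {e e′ v v′} → _≡_ {A = Stack⁺ n d} (k , t , c , gs , e , v) (k , t , c , gs , e′ , v′)
  Stack⁺-≡ {d = d} k t c gs =
    cong₂ (λ x y → k , t , c , gs , x , y) (ℕₚ.≡-irrelevant _ _) (Fits-irrelevant (suc d) (((k , t) ∷ c) ∷ gs) _ _)

  Stack-bottom : ∀ n → Stack n 0 ↔ (n ≡ 0 ⊎ Stack⁺ n 0)
  Stack-bottom n = mk↔ₛ′ to from to∘from from∘to
    where
    to : Stack n 0 → n ≡ 0 ⊎ Stack⁺ n 0
    to (([] ∷ []) , e , v)              = inj₁ (sym e)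
    to ((((k , t) ∷ c) ∷ []) , e , v)   = inj₂ (k , t , c , [] , e , v)
    from : n ≡ 0 ⊎ Stack⁺ n 0 → Stack n 0
    from (inj₁ e)                      = ([] ∷ []) , sym e , (z≤n , tt)
    from (inj₂ (k , t , c , [] , e , v)) = (((k , t) ∷ c) ∷ []) , e , v
    to∘from : ∀ y → to (from y) ≡ y
    to∘from (inj₁ e)                      = cong inj₁ (ℕₚ.≡-irrelevant _ _)
    to∘from (inj₂ (k , t , c , [] , e , v)) = refl
    from∘to : ∀ x → from (to x) ≡ x
    from∘to (([] ∷ []) , e , v)            = Stack-≡ ([] ∷ [])
    from∘to ((((k , t) ∷ c) ∷ []) , e , v) = refl

  Stack-pop : ∀ n {d} → suc d ≤ h → Stack n (suc d) ↔ (Stack n d ⊎ Stack⁺ n (suc d))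
  Stack-pop n {d} d<h = mk↔ₛ′ to from to∘from from∘to
    where
    to : Stack n (suc d) → Stack n d ⊎ Stack⁺ n (suc d)
    to (([] ∷ gs) , e , (_ , v))          = inj₁ (gs , e , v)
    to ((((k , t) ∷ c) ∷ gs) , e , v)     = inj₂ (k , t , c , gs , e , v)
    from : Stack n d ⊎ Stack⁺ n (suc d) → Stack n (suc d)
    from (inj₁ (gs , e , v))              = ([] ∷ gs) , e , (subst (_≤ h) (sym (ℕₚ.+-identityʳ (suc d))) d<h , v)
    from (inj₂ (k , t , c , gs , e , v))  = (((k , t) ∷ c) ∷ gs) , e , v
    to∘from : ∀ y → to (from y) ≡ y
    to∘from (inj₁ _) = refl
    to∘from (inj₂ _) = refl
    from∘to : ∀ x → from (to x) ≡ x
    from∘to (([] ∷ gs) , e , v)           = Stack-≡ ([] ∷ gs)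
    from∘to ((((k , t) ∷ c) ∷ gs) , e , v) = refl

  Stack-too-deep : ∀ n {d} → ¬ suc d ≤ h → ¬ Stack n (suc d)
  Stack-too-deep n d≮h ((g ∷ gs) , e , (fits , _)) = d≮h (ℕₚ.≤-trans (ℕₚ.m≤m+n _ (heightF g)) fits)

  Stack⁺-empty : ∀ {d} → ¬ Stack⁺ 0 d
  Stack⁺-empty (k , t , c , gs , () , v)

  -- The first child (k , t) is either reached (k = 0: its children become a new top forest)
  -- or loses one of its k + 1 parallel edges.
  Stack⁺-step : ∀ n d → Stack⁺ (suc n) d ↔ (Stack n (suc d) ⊎ Stack⁺ n d)
  Stack⁺-step n d = mk↔ₛ′ to from to∘from from∘to
    where
    reassoc : ∀ cs c gs → sizeF cs ℕ.+ sizeF c ℕ.+ totalSize gs ≡ sizeF cs ℕ.+ (sizeF c ℕ.+ totalSize gs)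
    reassoc cs c gs = ℕₚ.+-assoc (sizeF cs) (sizeF c) (totalSize gs)
    split : ∀ a b → d ℕ.+ (a ⊔ b) ≤ h → d ℕ.+ a ≤ h × d ℕ.+ b ≤ h
    split a b q = ℕₚ.≤-trans (ℕₚ.+-monoʳ-≤ d (ℕₚ.m≤m⊔n a b)) q , ℕₚ.≤-trans (ℕₚ.+-monoʳ-≤ d (ℕₚ.m≤n⊔m a b)) q
    join : ∀ a b → d ℕ.+ a ≤ h → d ℕ.+ b ≤ h → d ℕ.+ (a ⊔ b) ≤ h
    join a b q q′ = subst (_≤ h) (sym (ℕₚ.+-distribˡ-⊔ d a b)) (ℕₚ.⊔-lub q q′)
    to : Stack⁺ (suc n) d → Stack n (suc d) ⊎ Stack⁺ n d
    to (zero , node cs , c , gs , e , (q , v)) =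
      inj₁ ((cs ∷ c ∷ gs) , trans (sym (reassoc cs c gs)) (ℕₚ.suc-injective e) ,
            (subst (_≤ h) (ℕₚ.+-suc d (heightF cs)) (proj₁ (split (suc (heightF cs)) (heightF c) q)) ,
             (proj₂ (split (suc (heightF cs)) (heightF c) q) , v)))
    to (suc k , t , c , gs , e , v) = inj₂ (k , t , c , gs , ℕₚ.suc-injective e , v)
    from : Stack n (suc d) ⊎ Stack⁺ n d → Stack⁺ (suc n) d
    from (inj₁ ((cs ∷ c ∷ gs) , e , (q₁ , (q₂ , v)))) =
      zero , node cs , c , gs , cong suc (trans (reassoc cs c gs) e) ,
      (join (suc (heightF cs)) (heightF c) (subst (_≤ h) (sym (ℕₚ.+-suc d (heightF cs))) q₁) q₂ , v)
    from (inj₂ (k , t , c , gs , e , v)) = suc k , t , c , gs , cong suc e , v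
    to∘from : ∀ y → to (from y) ≡ y
    to∘from (inj₁ ((cs ∷ c ∷ gs) , e , v)) = cong inj₁ (Stack-≡ (cs ∷ c ∷ gs))
    to∘from (inj₂ (k , t , c , gs , e , v)) = cong inj₂ (Stack⁺-≡ k t c gs)
    from∘to : ∀ x → from (to x) ≡ x
    from∘to (zero , node cs , c , gs , e , v) = Stack⁺-≡ zero (node cs) c gs
    from∘to (suc k , t , c , gs , e , v)      = Stack⁺-≡ (suc k) t c gs

  stackCount stack⁺Count : ℕ → ℕ → ℕ
  stackCount n zero = [ n ≤ 0 ] ℕ.+ stack⁺Count n 0
  stackCount n (suc d) with suc d ℕ.≤? h
  ... | yes _ = stackCount n d ℕ.+ stack⁺Count n (suc d)
  ... | no  _ = 0

  stack⁺Count zero    d = 0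
  stack⁺Count (suc n) d = stackCount n (suc d) ℕ.+ stack⁺Count n d

  Stack↔Fin  : ∀ n d → Stack n d ↔ Fin (stackCount n d)
  Stack⁺↔Fin : ∀ n d → Stack⁺ n d ↔ Fin (stack⁺Count n d)

  Stack↔Fin n zero = ↔-trans (Stack-bottom n) (⊎-↔-Fin (≡0↔Fin n) (Stack⁺↔Fin n 0))
  Stack↔Fin n (suc d) with suc d ℕ.≤? h
  ... | yes d<h = ↔-trans (Stack-pop n d<h) (⊎-↔-Fin (Stack↔Fin n d) (Stack⁺↔Fin n (suc d)))
  ... | no  d≮h = ¬↔Fin0 (Stack-too-deep n d≮h)

  Stack⁺↔Fin zero    d = ¬↔Fin0 Stack⁺-empty
  Stack⁺↔Fin (suc n) d = ↔-trans (Stack⁺-step n d) (⊎-↔-Fin (Stack↔Fin n (suc d)) (Stack⁺↔Fin n d))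

  Tree≤ : ℕ → Set
  Tree≤ n = Σ[ t ∈ MTree ] (size t ≡ n × height t ≤ h)

  Tree≤↔Stack : ∀ n → Tree≤ n ↔ Stack n 0
  Tree≤↔Stack n = mk↔ₛ′ to from to∘from from∘to
    where
    to : Tree≤ n → Stack n 0
    to (node cs , e , p) = (cs ∷ []) , trans (ℕₚ.+-identityʳ (sizeF cs)) e , (p , tt)
    from : Stack n 0 → Tree≤ n
    from ((cs ∷ []) , e , (p , tt)) = node cs , trans (sym (ℕₚ.+-identityʳ (sizeF cs))) e , p
    to∘from : ∀ y → to (from y) ≡ y
    to∘from ((cs ∷ []) , e , v) = Stack-≡ (cs ∷ [])
    from∘to : ∀ x → from (to x) ≡ x
    from∘to (node cs , e , p) = cong (λ e′ → node cs , e′ , p) (ℕₚ.≡-irrelevant _ _)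

module ClosedForm (h : ℕ) where

  P : ℕ
  P = suc (suc h)

  -- As power series, ρ = 1/(1 - X^P), r = (1 - X²)/(1 - X^P) and v e = (1+X)^e (1 - X^(P-e)) r.
  ρ r : Seq
  ρ a = δ (a % P)
  r   = ρ ⊟ X^ 2 · ρ

  v : ℕ → Seq
  v e = [1+X]^ e · r ⊟ X^ (P ℕ.∸ e) · [1+X]^ e · r

  ρ-periodic : ρ ⊟ X^ P · ρ ≗ δ
  ρ-periodic a with a ℕ.<? P
  ... | yes a<P = begin
    ρ a - (X^ P · ρ) a ≡⟨ cong₂ _-_ (cong δ (m<n⇒m%n≡m a<P)) (X^-below P ρ a<P) ⟩
    δ a - + 0          ≡⟨ ℤₚ.+-identityʳ (δ a) ⟩
    δ a                ∎
  ... | no a≮P = subst (λ a → ρ a - (X^ P · ρ) a ≡ δ a) (ℕₚ.m+[n∸m]≡n (ℕₚ.≮⇒≥ a≮P)) (beyond (a ℕ.∸ P))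
    where
    beyond : ∀ b → ρ (P ℕ.+ b) - (X^ P · ρ) (P ℕ.+ b) ≡ + 0
    beyond b = begin
      ρ (P ℕ.+ b) - (X^ P · ρ) (P ℕ.+ b)
        ≡⟨ cong₂ _-_ (cong δ (trans (cong (_% P) (ℕₚ.+-comm P b)) ([m+n]%n≡m%n b P))) (X^-shift P ρ b) ⟩
      ρ b - ρ b ≡⟨ ℤₚ.+-inverseʳ (ρ b) ⟩
      + 0       ∎

  r-periodic : r ⊟ X^ P · r ≗ δ ⊟ X^ 2 · δ
  r-periodic a = begin
    r a - (X^ P · r) a
      ≡⟨ cong (λ x → r a - x) (trans (X^-⊟ P ρ (X^ 2 · ρ) a) (cong (λ x → (X^ P · ρ) a - x) (X^-X^ a))) ⟩
    (ρ a - (X^ 2 · ρ) a) - ((X^ P · ρ) a - (X^ 2 · X^ P · ρ) a)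
      ≡⟨ interchange (ρ a) ((X^ 2 · ρ) a) ((X^ P · ρ) a) ((X^ 2 · X^ P · ρ) a) ⟩
    (ρ a - (X^ P · ρ) a) - ((X^ 2 · ρ) a - (X^ 2 · X^ P · ρ) a)
      ≡⟨ cong (λ x → (ρ a - (X^ P · ρ) a) - x) (X^-⊟ 2 ρ (X^ P · ρ) a) ⟨
    (ρ a - (X^ P · ρ) a) - (X^ 2 · (ρ ⊟ X^ P · ρ)) a
      ≡⟨ cong₂ _-_ (ρ-periodic a) (X^-cong 2 ρ-periodic a) ⟩
    δ a - (X^ 2 · δ) a ∎
    where
    X^-X^ : ∀ a → (X^ P · X^ 2 · ρ) a ≡ (X^ 2 · X^ P · ρ) a
    X^-X^ a = trans (X^-X· P (X· ρ) a) (X·-cong (X^-X· P ρ) a)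
    interchange : ∀ p q s t → (p - q) - (s - t) ≡ (p - s) - (q - t)
    interchange = solve-∀

  P∸ : ∀ {e} → e ≤ h → P ℕ.∸ e ≡ suc (suc (h ℕ.∸ e))
  P∸ e≤h = trans (suc-∸ (ℕₚ.m≤n⇒m≤1+n e≤h)) (cong suc (suc-∸ e≤h))

  v-exponent : ∀ e {k} → P ℕ.∸ e ≡ k → v e ≗ [1+X]^ e · r ⊟ X^ k · [1+X]^ e · r
  v-exponent e refl a = refl

  v-vanish : ∀ {e} → P ≤ e → ∀ a → v e a ≡ + 0
  v-vanish {e} P≤e a =
    trans (v-exponent e (ℕₚ.m≤n⇒m∸n≡0 P≤e) a) (ℤₚ.+-inverseʳ (([1+X]^ e · r) a))

  v-step : ∀ {e} → e ≤ h → [1+X]^ 2 · (v (suc e) ⊟ v e) ≗ X· v (suc (suc e))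
  v-step {e} e≤h a = begin
    ([1+X]^ 2 · (v (suc e) ⊟ v e)) a
      ≡⟨ [1+X]^-cong 2 (⊟-cong (v-exponent (suc e) (suc-∸ e≤h))
                               (v-exponent e (P∸ e≤h))) a ⟩
    ([1+X]^ 2 · (([1+X]· V ⊟ X^ suc b · [1+X]· V) ⊟ (V ⊟ X^ suc (suc b) · V))) a
      ≡⟨ [1+X]²-difference V b a ⟩
    (X· v (suc (suc e))) a ∎
    where
    V = [1+X]^ e · r
    b = h ℕ.∸ e

  [1+X]^·r-at-0 : ∀ e → ([1+X]^ e · r) 0 ≡ + 1
  [1+X]^·r-at-0 zero    = refl
  [1+X]^·r-at-0 (suc e) = trans (ℤₚ.+-identityʳ _) ([1+X]^·r-at-0 e)

  [1+X]^·r-at-1 : ∀ e → ([1+X]^ e · r) 1 ≡ + e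
  [1+X]^·r-at-1 zero    = refl
  [1+X]^·r-at-1 (suc e) = trans (cong₂ _+_ ([1+X]^·r-at-1 e) ([1+X]^·r-at-0 e)) (cong +_ (ℕₚ.+-comm e 1))

  v-at-1 : ∀ {e} → e ≤ h → v e 1 ≡ + e
  v-at-1 {e} e≤h = begin
    v e 1 ≡⟨ v-exponent e (P∸ e≤h) 1 ⟩
    ([1+X]^ e · r) 1 - + 0 ≡⟨ ℤₚ.+-identityʳ _ ⟩
    ([1+X]^ e · r) 1       ≡⟨ [1+X]^·r-at-1 e ⟩
    + e                    ∎

  v-at-1-top : v (suc h) 1 ≡ + h
  v-at-1-top = begin
    v (suc h) 1 ≡⟨ v-exponent (suc h) (trans (suc-∸ (ℕₚ.≤-refl {h})) (cong suc (ℕₚ.n∸n≡0 h))) 1 ⟩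
    ([1+X]^ suc h · r) 1 - ([1+X]^ suc h · r) 0 ≡⟨ cong₂ _-_ ([1+X]^·r-at-1 (suc h)) ([1+X]^·r-at-0 (suc h)) ⟩
    + suc h - + 1 ≡⟨ cancel (+ h) ⟩
    + h ∎
    where
    cancel : ∀ x → (+ 1 + x) - + 1 ≡ x
    cancel = solve-∀

  stackFormula stack⁺Formula : ℕ → ℕ → ℤ
  stackFormula zero    d = + [ d ≤ h ]
  stackFormula (suc m) d = coeffT m (suc m) 0 (v (suc d))

  stack⁺Formula zero    d = + 0
  stack⁺Formula (suc m) d = coeffT m (suc m) 0 (v (suc d) ⊟ v d)

  coeffT-v0 : ∀ m → coeffT m (suc m) 0 (v 0) ≡ + 0
  coeffT-v0 m = begin
    coeffT m (suc m) 0 (v 0)                     ≡⟨ coeffT-cong m (suc m) 0 r-periodic ⟩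
    coeffT m (suc m) 0 (δ ⊟ X^ 2 · δ)             ≡⟨ coeffT-⊟ m (suc m) 0 δ (X^ 2 · δ) ⟩
    coeffT m (suc m) 0 δ - coeffT m (suc m) 0 (X^ 2 · δ)
      ≡⟨ cong₂ _-_ (coeffT-δ m (suc m) 0) (trans (coeffT-X^ m (suc m) 2 0 δ) (coeffT-δ m (suc m) 2)) ⟩
    tri m (+ suc m - + 0) - tri m (+ suc m - + 2)
      ≡⟨ cong₂ (λ x y → tri m x - tri m y) (above (+ m)) (below (+ m)) ⟩
    tri m (+ m + + 1) - tri m (+ m - + 1) ≡⟨ cong (_- tri m (+ m - + 1)) (tri-palindromic m (+ 1)) ⟩
    tri m (+ m - + 1) - tri m (+ m - + 1) ≡⟨ ℤₚ.+-inverseʳ (tri m (+ m - + 1)) ⟩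
    + 0 ∎
    where
    above : ∀ M → (+ 1 + M) - + 0 ≡ M + + 1
    above = solve-∀
    below : ∀ M → (+ 1 + M) - + 2 ≡ M - + 1
    below = solve-∀

  stackFormula-zero : ∀ m → stackFormula (suc m) 0 ≡ stack⁺Formula (suc m) 0
  stackFormula-zero m = sym (begin
    coeffT m (suc m) 0 (v 1 ⊟ v 0)                        ≡⟨ coeffT-⊟ m (suc m) 0 (v 1) (v 0) ⟩
    coeffT m (suc m) 0 (v 1) - coeffT m (suc m) 0 (v 0)   ≡⟨ cong (coeffT m (suc m) 0 (v 1) -_) (coeffT-v0 m) ⟩
    coeffT m (suc m) 0 (v 1) - + 0                        ≡⟨ ℤₚ.+-identityʳ _ ⟩
    coeffT m (suc m) 0 (v 1)                              ∎)

  stackFormula-suc : ∀ n {d} → suc d ≤ h → stackFormula n (suc d) ≡ stackFormula n d + stack⁺Formula n (suc d)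
  stackFormula-suc zero    {d} d<h = begin
    + [ suc d ≤ h ]     ≡⟨ cong +_ (trans ([≤]-true d<h) (sym ([≤]-true (ℕₚ.<⇒≤ d<h)))) ⟩
    + [ d ≤ h ]         ≡⟨ ℤₚ.+-identityʳ _ ⟨
    + [ d ≤ h ] + + 0   ∎
  stackFormula-suc (suc m) {d} _   = begin
    coeffT m (suc m) 0 (v (2 ℕ.+ d))
      ≡⟨ telescope (coeffT m (suc m) 0 (v (2 ℕ.+ d))) (coeffT m (suc m) 0 (v (suc d))) ⟩
    coeffT m (suc m) 0 (v (suc d)) + (coeffT m (suc m) 0 (v (2 ℕ.+ d)) - coeffT m (suc m) 0 (v (suc d)))
      ≡⟨ cong (λ x → coeffT m (suc m) 0 (v (suc d)) + x) (coeffT-⊟ m (suc m) 0 (v (2 ℕ.+ d)) (v (suc d))) ⟨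
    coeffT m (suc m) 0 (v (suc d)) + coeffT m (suc m) 0 (v (2 ℕ.+ d) ⊟ v (suc d)) ∎
    where
    telescope : ∀ x y → x ≡ y + (x - y)
    telescope = solve-∀

  stackFormula-vanish : ∀ n {d} → h < d → stackFormula n d ≡ + 0
  stackFormula-vanish zero    h<d = cong +_ ([≤]-false h<d)
  stackFormula-vanish (suc m) h<d = coeffT-zero m (suc m) 0 _ (v-vanish (s≤s h<d))

  stack⁺Formula-suc : ∀ n {d} → d ≤ h → stack⁺Formula (suc n) d ≡ stackFormula n (suc d) + stack⁺Formula n d
  stack⁺Formula-suc zero {d} d≤h = begin
    coeffT 0 1 0 (v (suc d) ⊟ v d) ≡⟨ coeffT-at-0-1 (v (suc d) ⊟ v d) ⟩
    v (suc d) 1 - v d 1            ≡⟨ increment (ℕₚ.m≤n⇒m<n∨m≡n d≤h) ⟩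
    + [ suc d ≤ h ]                ≡⟨ ℤₚ.+-identityʳ _ ⟨
    + [ suc d ≤ h ] + + 0          ∎
    where
    increment : d < h ⊎ d ≡ h → v (suc d) 1 - v d 1 ≡ + [ suc d ≤ h ]
    increment (inj₁ d<h) = begin
      v (suc d) 1 - v d 1 ≡⟨ cong₂ _-_ (v-at-1 d<h) (v-at-1 d≤h) ⟩
      + suc d - + d       ≡⟨ one (+ d) ⟩
      + 1                 ≡⟨ cong +_ ([≤]-true d<h) ⟨
      + [ suc d ≤ h ]     ∎
      where
      one : ∀ x → (+ 1 + x) - x ≡ + 1
      one = solve-∀
    increment (inj₂ refl) = begin
      v (suc d) 1 - v d 1 ≡⟨ cong₂ _-_ v-at-1-top (v-at-1 d≤h) ⟩
      + d - + d           ≡⟨ ℤₚ.+-inverseʳ (+ d) ⟩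
      + 0                 ≡⟨ cong +_ ([≤]-false (ℕₚ.n<1+n d)) ⟨
      + [ suc d ≤ d ]     ∎
  stack⁺Formula-suc (suc m) {d} d≤h = begin
    coeffT (suc m) N 0 w                                 ≡⟨ coeffT-suc-[1+X]² m N 0 w ⟩
    coeffT m N 1 w + coeffT m N 0 ([1+X]^ 2 · w)         ≡⟨ cong (λ x → coeffT m N 1 w + x) (coeffT-cong m N 0 (v-step d≤h)) ⟩
    coeffT m N 1 w + coeffT m N 0 (X· v (2 ℕ.+ d))       ≡⟨ cong (λ x → coeffT m N 1 w + x) (coeffT-X· m N 0 (v (2 ℕ.+ d))) ⟩
    coeffT m N 1 w + coeffT m N 1 (v (2 ℕ.+ d))
      ≡⟨ cong₂ _+_ (coeffT-suc-suc m (suc m) 0 w) (coeffT-suc-suc m (suc m) 0 (v (2 ℕ.+ d))) ⟩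
    stack⁺Formula (suc m) d + stackFormula (suc m) (suc d)
      ≡⟨ ℤₚ.+-comm (stack⁺Formula (suc m) d) (stackFormula (suc m) (suc d)) ⟩
    stackFormula (suc m) (suc d) + stack⁺Formula (suc m) d ∎
    where
    N = 2 ℕ.+ m
    w = v (suc d) ⊟ v d

  v1-complement : [1+X]· (δ ⊟ X^ 2 · δ) ⊟ v 1 ≗ X^ suc h · (r ⊟ X^ 2 · r)
  v1-complement a = begin
    ([1+X]· (δ ⊟ X^ 2 · δ)) a - v 1 a
      ≡⟨ cong (_- v 1 a) ([1+X]-cong (λ b → sym (r-periodic b)) a) ⟩
    ([1+X]· (r ⊟ X^ P · r)) a - v 1 a
      ≡⟨ cong (_- v 1 a) ([1+X]-⊟ r (X^ P · r) a) ⟩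
    (([1+X]· r) a - ([1+X]· X· Z) a) - (([1+X]· r) a - (X^ suc h · [1+X]· r) a)
      ≡⟨ cong (λ y → (([1+X]· r) a - ([1+X]· X· Z) a) - (([1+X]· r) a - y)) (X^-[1+X] (suc h) r a) ⟩
    (([1+X]· r) a - ((X· Z) a + (X· X· Z) a)) - (([1+X]· r) a - (Z a + (X· Z) a))
      ≡⟨ cancel (([1+X]· r) a) (Z a) ((X· Z) a) ((X· X· Z) a) ⟩
    Z a - (X· X· Z) a
      ≡⟨ cong (λ x → Z a - x) (trans (X^-X· (suc h) (X· r) a) (X·-cong (X^-X· (suc h) r) a)) ⟨
    Z a - (X^ suc h · X^ 2 · r) a ≡⟨ X^-⊟ (suc h) r (X^ 2 · r) a ⟨
    (X^ suc h · (r ⊟ X^ 2 · r)) a ∎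
    where
    Z = X^ suc h · r
    cancel : ∀ e z xz xxz → (e - (xz + xxz)) - (e - (z + xz)) ≡ z - xxz
    cancel = solve-∀

  stackFormula-at-0 : ∀ m → stackFormula (suc m) 0
    ≡ coeffT m (suc m) 0 ([1+X]· (δ ⊟ X^ 2 · δ)) - coeffT m (suc m) (suc h) (r ⊟ X^ 2 · r)
  stackFormula-at-0 m = begin
    coeffT m n 0 (v 1)                     ≡⟨ difference (coeffT m n 0 g) (coeffT m n 0 (v 1)) ⟩
    coeffT m n 0 g - (coeffT m n 0 g - coeffT m n 0 (v 1))
      ≡⟨ cong (λ x → coeffT m n 0 g - x) (coeffT-⊟ m n 0 g (v 1)) ⟨
    coeffT m n 0 g - coeffT m n 0 (g ⊟ v 1)
      ≡⟨ cong (λ x → coeffT m n 0 g - x) (trans (coeffT-cong m n 0 v1-complement) (coeffT-X^ m n (suc h) 0 _)) ⟩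
    coeffT m n 0 g - coeffT m n (suc h ℕ.+ 0) (r ⊟ X^ 2 · r)
      ≡⟨ cong (λ j → coeffT m n 0 g - coeffT m n j (r ⊟ X^ 2 · r)) (ℕₚ.+-identityʳ (suc h)) ⟩
    coeffT m n 0 g - coeffT m n (suc h) (r ⊟ X^ 2 · r) ∎
    where
    n = suc m
    g = [1+X]· (δ ⊟ X^ 2 · δ)
    difference : ∀ x y → y ≡ x - (x - y)
    difference = solve-∀

  coeffT-ρ-unfold : ∀ m n j → coeffT m n j ρ ≡ tri m (+ n - + j) + coeffT m n (P ℕ.+ j) ρ
  coeffT-ρ-unfold m n j = begin
    coeffT m n j ρ                         ≡⟨ coeffT-cong m n j ρ≗δ⊞X^Pρ ⟩
    coeffT m n j (δ ⊞ X^ P · ρ)             ≡⟨ coeffT-⊞ m n j δ (X^ P · ρ) ⟩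
    coeffT m n j δ + coeffT m n j (X^ P · ρ) ≡⟨ cong₂ _+_ (coeffT-δ m n j) (coeffT-X^ m n P j ρ) ⟩
    tri m (+ n - + j) + coeffT m n (P ℕ.+ j) ρ ∎
    where
    add-back : ∀ x y → x ≡ (x - y) + y
    add-back = solve-∀
    ρ≗δ⊞X^Pρ : ρ ≗ δ ⊞ X^ P · ρ
    ρ≗δ⊞X^Pρ a = trans (add-back (ρ a) ((X^ P · ρ) a)) (cong (_+ (X^ P · ρ) a) (ρ-periodic a))

  coeffT-ρ-partial : ∀ m n j K →
    coeffT m n j ρ ≡ sumTo K (λ k → tri m (+ n - + (P ℕ.* k ℕ.+ j))) + coeffT m n (P ℕ.* K ℕ.+ j) ρ
  coeffT-ρ-partial m n j zero = begin
    coeffT m n j ρ ≡⟨ cong (λ i → coeffT m n (i ℕ.+ j) ρ) (ℕₚ.*-zeroʳ P) ⟨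
    coeffT m n (P ℕ.* 0 ℕ.+ j) ρ ≡⟨ ℤₚ.+-identityˡ _ ⟨
    + 0 + coeffT m n (P ℕ.* 0 ℕ.+ j) ρ ∎
  coeffT-ρ-partial m n j (suc K) = begin
    coeffT m n j ρ ≡⟨ coeffT-ρ-partial m n j K ⟩
    S + coeffT m n (P ℕ.* K ℕ.+ j) ρ ≡⟨ cong (λ x → S + x) (coeffT-ρ-unfold m n (P ℕ.* K ℕ.+ j)) ⟩
    S + (tri m (+ n - + (P ℕ.* K ℕ.+ j)) + coeffT m n (P ℕ.+ (P ℕ.* K ℕ.+ j)) ρ)
      ≡⟨ ℤₚ.+-assoc S _ _ ⟨
    S + tri m (+ n - + (P ℕ.* K ℕ.+ j)) + coeffT m n (P ℕ.+ (P ℕ.* K ℕ.+ j)) ρ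
      ≡⟨ cong (λ i → S + tri m (+ n - + (P ℕ.* K ℕ.+ j)) + coeffT m n i ρ) next-block ⟩
    S + tri m (+ n - + (P ℕ.* K ℕ.+ j)) + coeffT m n (P ℕ.* suc K ℕ.+ j) ρ ∎
    where
    S = sumTo K (λ k → tri m (+ n - + (P ℕ.* k ℕ.+ j)))
    next-block : P ℕ.+ (P ℕ.* K ℕ.+ j) ≡ P ℕ.* suc K ℕ.+ j
    next-block = trans (sym (ℕₚ.+-assoc P (P ℕ.* K) j)) (cong (ℕ._+ j) (sym (ℕₚ.*-suc P K)))

  coeffT-ρ : ∀ m n j → coeffT m n j ρ ≡ sumTo (suc n) (λ k → tri m (+ n - + (P ℕ.* k ℕ.+ j)))
  coeffT-ρ m n j = begin
    coeffT m n j ρ ≡⟨ coeffT-ρ-partial m n j (suc n) ⟩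
    S + coeffT m n (P ℕ.* suc n ℕ.+ j) ρ ≡⟨ cong (λ x → S + x) (coeffT-vanish m ρ n<Pn+P+j) ⟩
    S + + 0 ≡⟨ ℤₚ.+-identityʳ S ⟩
    S ∎
    where
    S = sumTo (suc n) (λ k → tri m (+ n - + (P ℕ.* k ℕ.+ j)))
    n<Pn+P+j : n < P ℕ.* suc n ℕ.+ j
    n<Pn+P+j = ℕₚ.≤-trans (ℕₚ.m≤n*m (suc n) P) (ℕₚ.m≤m+n (P ℕ.* suc n) j)

  formula≡coeffT : ∀ m → formula (suc m) h ≡ coeffT m (suc m) (suc h) (r ⊟ X^ 2 · r)
  formula≡coeffT m = begin
    sumTo (suc n) (term n h)
      ≡⟨ sumTo-cong (suc n) (λ k _ → term≡ k) ⟩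
    sumTo (suc n) (λ k → t k j - + 2 * t k (2 ℕ.+ j) + t k (4 ℕ.+ j))
      ≡⟨ trans (sumTo-+ (suc n) _ _) (cong (_+ S (4 ℕ.+ j))
               (trans (sumTo-minus (suc n) _ _) (cong (λ x → S j - x) (sumTo-*ˡ (suc n) (+ 2) _)))) ⟩
    S j - + 2 * S (2 ℕ.+ j) + S (4 ℕ.+ j)
      ≡⟨ second-difference (S j) (S (2 ℕ.+ j)) (S (4 ℕ.+ j)) ⟨
    (S j - S (2 ℕ.+ j)) - (S (2 ℕ.+ j) - S (4 ℕ.+ j))
      ≡⟨ cong₂ _-_ (coeffT-r j) (coeffT-r (2 ℕ.+ j)) ⟨
    coeffT m n j r - coeffT m n (2 ℕ.+ j) r
      ≡⟨ cong (λ x → coeffT m n j r - x) (coeffT-X^ m n 2 j r) ⟨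
    coeffT m n j r - coeffT m n j (X^ 2 · r) ≡⟨ coeffT-⊟ m n j r (X^ 2 · r) ⟨
    coeffT m n j (r ⊟ X^ 2 · r) ∎
    where
    n = suc m
    j = suc h
    t : ℕ → ℕ → ℤ
    t k i = tri m (+ n - + (P ℕ.* k ℕ.+ i))
    S : ℕ → ℤ
    S i = sumTo (suc n) (λ k → t k i)
    coeffT-r : ∀ i → coeffT m n i r ≡ S i - S (2 ℕ.+ i)
    coeffT-r i = trans (coeffT-⊟ m n i ρ (X^ 2 · ρ))
                       (cong₂ _-_ (coeffT-ρ m n i) (trans (coeffT-X^ m n 2 i ρ) (coeffT-ρ m n (2 ℕ.+ i))))
    second-difference : ∀ a b c → (a - b) - (b - c) ≡ a - + 2 * b + c
    second-difference = solve-∀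
    regroup : ∀ N A B c → N - A - B - c ≡ N - (B + (c + A))
    regroup = solve-∀
    index : ∀ k c → + n - + (h ℕ.+ 1) - + ((h ℕ.+ 2) ℕ.* k) - + c ≡ + n - + (P ℕ.* k ℕ.+ (c ℕ.+ j))
    index k c = trans (cong₂ (λ x y → + n - + x - + y - + c) (ℕₚ.+-comm h 1) (cong (ℕ._* k) (ℕₚ.+-comm h 2)))
                      (regroup (+ n) (+ j) (+ (P ℕ.* k)) (+ c))
    term≡ : ∀ k → term n h k ≡ t k j - + 2 * t k (2 ℕ.+ j) + t k (4 ℕ.+ j)
    term≡ k = cong₂ (λ x y → x + tri m y) (cong₂ (λ x y → tri m x - + 2 * tri m y) (index k 0) (index k 2)) (index k 4)

module Counting (h : ℕ) where
  open Traversal h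
  open ClosedForm h

  stackCount-formula  : ∀ n d → + stackCount n d ≡ stackFormula n d
  stack⁺Count-formula : ∀ n {d} → d ≤ h → + stack⁺Count n d ≡ stack⁺Formula n d

  stackCount-formula zero    zero = refl
  stackCount-formula (suc m) zero = trans (stack⁺Count-formula (suc m) z≤n) (sym (stackFormula-zero m))
  stackCount-formula n (suc d) with suc d ℕ.≤? h
  ... | yes d<h = trans (cong₂ _+_ (stackCount-formula n d) (stack⁺Count-formula n d<h))
                        (sym (stackFormula-suc n d<h))
  ... | no  d≮h = sym (stackFormula-vanish n (ℕₚ.≰⇒> d≮h))

  stack⁺Count-formula zero    _         = refl
  stack⁺Count-formula (suc n) {d} d≤h = trans (cong₂ _+_ (stackCount-formula n (suc d)) (stack⁺Count-formula n d≤h))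
                                              (sym (stack⁺Formula-suc n d≤h))

  Tree≤-count : ∀ n → Σ[ N ∈ ℕ ] (Tree≤ n ↔ Fin N × + N ≡ stackFormula n 0)
  Tree≤-count n = stackCount n 0 , ↔-trans (Tree≤↔Stack n) (Stack↔Fin n 0) , stackCount-formula n 0

-- Trees of height greater than h

height≤size  : ∀ t → height t ≤ size t
heightF≤sizeF : ∀ cs → heightF cs ≤ sizeF cs

height≤size (node cs) = heightF≤sizeF cs

heightF≤sizeF []             = z≤n
heightF≤sizeF ((k , t) ∷ cs) = ℕₚ.⊔-lub
  (ℕₚ.≤-trans (s≤s (ℕₚ.≤-trans (height≤size t) (ℕₚ.m≤n+m (size t) k))) (ℕₚ.m≤m+n (suc k ℕ.+ size t) (sizeF cs)))
  (ℕₚ.≤-trans (heightF≤sizeF cs) (ℕₚ.m≤n+m (sizeF cs) (suc k ℕ.+ size t)))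

Tall : ℕ → ℕ → Set
Tall h n = Σ[ t ∈ MTree ] (size t ≡ n × h < height t)

module _ (h n : ℕ) where
  open Traversal using (Tree≤)

  Taller : Tree≤ n n → Set
  Taller (t , _) = h < height t

  height-bounded : ∀ t → size t ≡ n → height t ≤ n
  height-bounded t e = subst (height t ≤_) e (height≤size t)

  Tall↔Taller : Tall h n ↔ Σ (Tree≤ n n) Taller
  Tall↔Taller = mk↔ₛ′ (λ { (t , e , p) → (t , e , height-bounded t e) , p }) (λ { ((t , e , _) , p) → t , e , p })
    (λ { ((t , e , q) , p) → cong (λ q′ → (t , e , q′) , p) (ℕₚ.≤-irrelevant _ _) }) (λ _ → refl)

  Tree≤-split : Tree≤ n n ↔ (Tree≤ h n ⊎ Σ (Tree≤ n n) Taller)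
  Tree≤-split = mk↔ₛ′ to from to∘from from∘to
    where
    to : Tree≤ n n → Tree≤ h n ⊎ Σ (Tree≤ n n) Taller
    to (t , e , q) with height t ℕ.≤? h
    ... | yes p = inj₁ (t , e , p)
    ... | no ¬p = inj₂ ((t , e , q) , ℕₚ.≰⇒> ¬p)
    from : Tree≤ h n ⊎ Σ (Tree≤ n n) Taller → Tree≤ n n
    from (inj₁ (t , e , p)) = t , e , height-bounded t e
    from (inj₂ (s , _))     = s
    to∘from : ∀ y → to (from y) ≡ y
    to∘from (inj₁ (t , e , p)) with height t ℕ.≤? h
    ... | yes p′ = cong (λ p″ → inj₁ (t , e , p″)) (ℕₚ.≤-irrelevant p′ p)
    ... | no ¬p  = ⊥-elim (¬p p)
    to∘from (inj₂ ((t , e , q) , p)) with height t ℕ.≤? h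
    ... | yes p′ = ⊥-elim (ℕₚ.<⇒≱ p p′)
    ... | no ¬p  = cong (λ p″ → inj₂ ((t , e , q) , p″)) (ℕₚ.<-irrelevant _ p)
    from∘to : ∀ x → from (to x) ≡ x
    from∘to (t , e , q) with height t ℕ.≤? h
    ... | yes p = cong (λ q′ → t , e , q′) (ℕₚ.≤-irrelevant _ q)
    ... | no ¬p = refl

  Tall-count : Σ[ N ∈ ℕ ] (Tall h n ↔ Fin N × + N ≡ ClosedForm.stackFormula n n 0 - ClosedForm.stackFormula h n 0)
  Tall-count with Counting.Tree≤-count n n | Counting.Tree≤-count h n
  ... | a , All↔a , a≡ | b , Short↔b , b≡
      with finite-subset All↔a Taller (λ s → h ℕ.<? height (proj₁ s)) (λ _ → ℕₚ.<-irrelevant)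
  ...   | p , Taller↔p = p , ↔-trans Tall↔Taller Taller↔p , (begin
    + p               ≡⟨ complement (+ p) (+ b) ⟩
    (+ b + + p) - + b ≡⟨ cong (λ c → + c - + b) a≡b+p ⟨
    + a - + b         ≡⟨ cong₂ _-_ a≡ b≡ ⟩
    ClosedForm.stackFormula n n 0 - ClosedForm.stackFormula h n 0 ∎)
    where
    a≡b+p : a ≡ b ℕ.+ p
    a≡b+p = ↔⇒≡ (↔-trans (↔-sym All↔a) (↔-trans Tree≤-split (⊎-↔-Fin Short↔b Taller↔p)))
    complement : ∀ x y → x ≡ (y + x) - y
    complement = solve-∀

formula-difference : ∀ h n → ClosedForm.stackFormula n n 0 - ClosedForm.stackFormula h n 0 ≡ formula n h
formula-difference h zero = sym (cong (λ x → + 0 + x) empty-sum)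
  where
  empty-sum : term 0 h 0 ≡ + 0
  empty-sum = cong (λ e → tri 0 (e - + 0) - + 2 * tri 0 (e - + 2) + tri 0 (e - + 4))
                   (cong₂ (λ x y → + 0 - + x - + y) (ℕₚ.+-comm h 1) (ℕₚ.*-zeroʳ (h ℕ.+ 2)))
formula-difference h (suc m) = begin
  stackFormula n n 0 - stackFormula h n 0
    ≡⟨ cong₂ _-_ (ClosedForm.stackFormula-at-0 n m) (ClosedForm.stackFormula-at-0 h m) ⟩
  (A - coeffT m n (suc n) (r n ⊟ X^ 2 · r n)) - (A - coeffT m n (suc h) (r h ⊟ X^ 2 · r h))
    ≡⟨ cong (λ x → (A - x) - (A - coeffT m n (suc h) (r h ⊟ X^ 2 · r h))) (coeffT-vanish m (r n ⊟ X^ 2 · r n) (ℕₚ.n<1+n n)) ⟩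
  (A - + 0) - (A - coeffT m n (suc h) (r h ⊟ X^ 2 · r h)) ≡⟨ cancel A _ ⟩
  coeffT m n (suc h) (r h ⊟ X^ 2 · r h) ≡⟨ ClosedForm.formula≡coeffT h m ⟨
  formula n h ∎
  where
  open ClosedForm using (stackFormula; r)
  n = suc m
  A = coeffT m n 0 ([1+X]· (δ ⊟ X^ 2 · δ))
  cancel : ∀ a b → (a - + 0) - (a - b) ≡ b
  cancel = solve-∀

theorem3p5 : (h n : ℕ) →
    Σ[ N ∈ ℕ ] ((Fin N ↔ (Σ[ t ∈ MTree ] (size t ≡ n × h < height t)))
      × (+ N ≡ formula n h))
theorem3p5 h n with Tall-count h n
... | N , Tall↔N , N≡ = N , ↔-sym Tall↔N , trans N≡ (formula-difference h n)
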